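{- Let $G$ be a finite graph and $H$ a subgraph of $G$. If $H$ is a retract of $G$, then $\sigma(H) \leq \sigma(G)$.
   Context: Surrounding Cops and Robbers on a finite simple graph $G$ with $k \geq 1$ cops and one robber: the cops first choose starting vertices (several cops may share a vertex), then the robber chooses a starting vertex not occupied by a cop, and thereafter the cops and the robber alternate moves, the cops moving first. In a move, each player may move to an adjacent vertex or stay put; the robber may never move to, or remain on, a vertex occupied by a cop, so if a cop moves onto the robber's vertex the robber is compelled to move to a neighbouring vertex not occupied by a cop. The cops win if at any time every neighbour of the robber's vertex is occupied by a cop; the robber wins if he avoids this forever. Play is with perfect information. The surrounding cop number $\sigma(G)$ is the least number of cops for which the cops have a winning strategy. $H$ is a retract of $G$ if there is a homomorphism $f : V(G) \to V(H)$ with $f(x) = x$ for all $x \in V(H)$; following the Cops and Robbers convention (Bonato–Nowakowski), graphs are regarded as reflexive, so a homomorphism maps adjacent vertices to vertices that are adjacent or equal. -}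

module Defs where

open import Data.Nat using (ℕ; _≤_)
open import Data.Fin using (Fin)
open import Data.Product using (Σ; ∃; _×_; _,_)
open import Data.Sum using (_⊎_)
open import Relation.Nullary using (¬_)
open import Relation.Binary.PropositionalEquality using (_≡_)

record Graph : Set₁ where
  field
    n      : ℕ
    Adj    : Fin n → Fin n → Set
    sym    : ∀ {u v} → Adj u v → Adj v u
    irrefl : ∀ {u} → ¬ Adj u u

  V : Set
  V = Fin n

open Graph public

-- H is (isomorphic to) a subgraph of G via an injective, edge-preserving map.
record Subgraph (H G : Graph) : Set where
  field
    ι      : V H → V G
    inj    : ∀ {x y} → ι x ≡ ι y → x ≡ y
    edges  : ∀ {x y} → Adj H x y → Adj G (ι x) (ι y)

open Subgraph public

-- H (a subgraph of G via s) is a retract of G: a reflexive-graph homomorphism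
-- f : V(G) → V(H) fixing every vertex of H.
IsRetract : (H G : Graph) → Subgraph H G → Set
IsRetract H G s =
  Σ (V G → V H) λ f →
    (∀ x → f (ι s x) ≡ x) ×
    (∀ {u v} → Adj G u v → Adj H (f u) (f v) ⊎ f u ≡ f v)

-- Surrounding Cops and Robbers with k cops on graph G.
module Game (G : Graph) (k : ℕ) where

  Config : Set
  Config = Fin k → V G

  Occupied : Config → V G → Set
  Occupied c v = ∃ λ i → c i ≡ v

  Surrounded : Config → V G → Set
  Surrounded c r = ∀ v → Adj G r v → Occupied c v

  CopMove : Config → Config → Set
  CopMove c c' = ∀ i → c' i ≡ c i ⊎ Adj G (c i) (c' i)

  RobberMove : Config → V G → V G → Set
  RobberMove c r r' = (r' ≡ r ⊎ Adj G r r') × ¬ Occupied c r'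

  -- CopsWin c r : cops at c, robber at r, cops to move; the cops can force
  -- a surrounding position in finitely many rounds (inductive attractor).
  data CopsWin (c : Config) (r : V G) : Set where
    surrounded : Surrounded c r → CopsWin c r
    move : (c' : Config) → CopMove c c' →
           (Surrounded c' r ⊎ (∀ r' → RobberMove c' r r' → CopsWin c' r')) →
           CopsWin c r

  KCopsWin : Set
  KCopsWin = 1 ≤ k × Σ Config λ c₀ → ∀ r₀ → ¬ Occupied c₀ r₀ → CopsWin c₀ r₀

CopsWinGame : Graph → ℕ → Set
CopsWinGame G k = Game.KCopsWin G k

IsSurroundingCopNumber : Graph → ℕ → Set
IsSurroundingCopNumber G s = CopsWinGame G s × (∀ k → CopsWinGame G k → s ≤ k)

module Submission where

-- Let ι : H → G embed H in G and let
-- f : G → H be a retraction, i.e. a reflexive-graph homomorphism with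
-- f ∘ ι = id.  Cops playing on H copy a winning strategy for G: they stand
-- on the images under f of the positions of the G-cops, while a robber on
-- vertex r of H is regarded as a robber on ι r in G.  Homomorphy of f turns
-- legal cop moves in G into legal cop moves in H; edge-preservation of ι
-- turns legal robber moves in H into legal robber moves in G; and f ∘ ι = id
-- transports "occupied" and "surrounded" from G back to H.

open import Defs
open import Data.Nat using (ℕ; _≤_)
open import Data.Product using (_,_)
open import Data.Sum using (_⊎_; inj₁; inj₂)
open import Relation.Nullary using (¬_)
open import Relation.Binary.PropositionalEquality
  using (_≡_; refl; cong; trans) renaming (sym to ≡-sym)

module Shadow (G H : Graph)
  (ι : V H → V G) (ι-edges : ∀ {x y} → Adj H x y → Adj G (ι x) (ι y))
  (f : V G → V H) (f-retracts : ∀ x → f (ι x) ≡ x)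
  (f-hom : ∀ {u v} → Adj G u v → Adj H (f u) (f v) ⊎ f u ≡ f v)
  (k : ℕ) where

  module InG = Game G k
  module InH = Game H k

  shadow : InG.Config → InH.Config
  shadow c i = f (c i)

  occupied-shadow : ∀ c r → InG.Occupied c (ι r) → InH.Occupied (shadow c) r
  occupied-shadow c r (i , ci≡ιr) = i , trans (cong f ci≡ιr) (f-retracts r)

  free-image : ∀ c r → ¬ InH.Occupied (shadow c) r → ¬ InG.Occupied c (ι r)
  free-image c r free occ = free (occupied-shadow c r occ)

  -- A legal cop move in G casts a legal cop move in H: each edge step maps
  -- to an edge step or to staying put, since f is a reflexive homomorphism.
  shadow-move : ∀ c c' → InG.CopMove c c' → InH.CopMove (shadow c) (shadow c')
  shadow-move c c' step i with step i
  ... | inj₁ stay = inj₁ (cong f stay)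
  ... | inj₂ edge with f-hom edge
  ...   | inj₁ edge' = inj₂ edge'
  ...   | inj₂ collapse = inj₁ (≡-sym collapse)

  -- If the robber on ι r is surrounded in G, the robber on r is surrounded
  -- by the shadows in H: a neighbour v of r gives the neighbour ι v of ι r.
  shadow-surrounds : ∀ c r → InG.Surrounded c (ι r) → InH.Surrounded (shadow c) r
  shadow-surrounds c r surr v r~v = occupied-shadow c v (surr (ι v) (ι-edges r~v))

  lift-robber : ∀ c r r' → InH.RobberMove (shadow c) r r' → InG.RobberMove c (ι r) (ι r')
  lift-robber c r r' (inj₁ stay , free) = inj₁ (cong ι stay) , free-image c r' free
  lift-robber c r r' (inj₂ edge , free) = inj₂ (ι-edges edge) , free-image c r' free

  shadow-wins : ∀ c r → InG.CopsWin c (ι r) → InH.CopsWin (shadow c) r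
  shadow-wins c r (InG.surrounded surr) = InH.surrounded (shadow-surrounds c r surr)
  shadow-wins c r (InG.move c' step (inj₁ surr)) =
    InH.move (shadow c') (shadow-move c c' step) (inj₁ (shadow-surrounds c' r surr))
  shadow-wins c r (InG.move c' step (inj₂ next)) =
    InH.move (shadow c') (shadow-move c c' step) (inj₂ λ r' robber-move →
      shadow-wins c' r' (next (ι r') (lift-robber c' r r' robber-move)))

  cops-win-transfers : CopsWinGame G k → CopsWinGame H k
  cops-win-transfers (k≥1 , c₀ , wins) =
    k≥1 , shadow c₀ , λ r₀ free → shadow-wins c₀ r₀ (wins (ι r₀) (free-image c₀ r₀ free))

theorem6 : (G H : Graph) (s : Subgraph H G) → IsRetract H G s →
    (σH σG : ℕ) → IsSurroundingCopNumber H σH → IsSurroundingCopNumber G σG →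
    σH ≤ σG
theorem6 G H s (f , f-retracts , f-hom) σH σG (_ , σH-least) (σG-cops-win , _) =
  σH-least σG (Shadow.cops-win-transfers G H (ι s) (edges s) f f-retracts f-hom σG σG-cops-win)
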